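{- Let $n\ge 2$ and $r\in\{2,3\}$. The graph $P_{n+r}+P_n$ admits a $2$-super graceful labeling whose edge-label set is $[2,2n+r-1]$.
   Context: $P_m$ is the path on $m$ vertices, and $G+H$ denotes the disjoint union of graphs $G$ and $H$. For integers $a\le b$, $[a,b]$ is the set of integers between $a$ and $b$ inclusive. For $k\ge 1$, a $k$-super graceful labeling of a graph $G=(V,E)$ with $p$ vertices and $q$ edges is a bijection $f:V\cup E\to[k,k+p+q-1]$ with $f(uv)=|f(u)-f(v)|$ for every edge $uv$. -}

module Defs where

open import Data.Nat using (ℕ; zero; suc; _+_; _∸_; _≤_; ∣_-_∣)
open import Data.Fin using (Fin; zero; suc; inject₁; _↑ˡ_; _↑ʳ_; splitAt)
open import Data.Product using (_×_; _,_; Σ; ∃)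
open import Data.Sum using (_⊎_; inj₁; inj₂)
open import Function.Definitions using (Injective)
open import Relation.Binary.PropositionalEquality using (_≡_)

record Graph : Set where
  field
    p        : ℕ
    q        : ℕ
    endpoint : Fin q → Fin p × Fin p
open Graph public

P : ℕ → Graph
P zero    = record { p = 0 ; q = 0 ; endpoint = λ () }
P (suc m) = record { p = suc m ; q = m ; endpoint = λ i → inject₁ i , suc i }

_⊕_ : Graph → Graph → Graph
G ⊕ H = record
  { p = p G + p H
  ; q = q G + q H
  ; endpoint = λ e → go (splitAt (q G) e)
  }
  where
  go : Fin (q G) ⊎ Fin (q H) → Fin (p G + p H) × Fin (p G + p H)
  go (inj₁ e) with endpoint G e
  ... | u , v = (u ↑ˡ p H) , (v ↑ˡ p H)
  go (inj₂ e) with endpoint H e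
  ... | u , v = (p G ↑ʳ u) , (p G ↑ʳ v)

Elem : Graph → Set
Elem G = Fin (p G) ⊎ Fin (q G)

InRange : ℕ → ℕ → ℕ → Set
InRange a b m = a ≤ m × m ≤ b

record SuperGraceful (k : ℕ) (G : Graph) (f : Elem G → ℕ) : Set where
  field
    injective : Injective _≡_ _≡_ f
    into      : ∀ x → InRange k (k + p G + q G ∸ 1) (f x)
    onto      : ∀ m → InRange k (k + p G + q G ∸ 1) m → ∃ λ x → f x ≡ m
    edgeLabel : ∀ e → f (inj₂ e) ≡ ∣ f (inj₁ (Data.Product.proj₁ (endpoint G e)))
                                    - f (inj₁ (Data.Product.proj₂ (endpoint G e))) ∣

EdgeLabelSet : (G : Graph) → (Elem G → ℕ) → ℕ → ℕ → Set
EdgeLabelSet G f a b =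
  (∀ e → InRange a b (f (inj₂ e))) × (∀ m → InRange a b m → ∃ λ e → f (inj₂ e) ≡ m)

module Submission where

-- Write the paths as P(a + 1) and P(b + 1) with a = b + r and let A = a + b + 1;
-- the graph has A + 1 vertices and A − 1 edges, so the labels are [2, 2A + 1].
-- It suffices to find sequences α 0, …, α a and β 0, …, β b which together take
-- every value in [0, A] and whose consecutive gaps together take every value in
-- [2, A]: label the vertices A + 1 + α i and A + 1 + β j, so that the edges carry
-- the gaps.  Surjectivity onto [2, 2A + 1] then gives everything else by
-- counting, since a map from at most M elements onto M values is a bijection.
--
-- The sequences are zigzags.  With a = 2t + 1 + e (e the parity bit), α
-- alternates between t, t − 1, …, 0 and 3 + b + t, …, A, producing the gaps
-- 3 + b, …, A, and ends at the missing value 2 + b (gap 2 + b); β alternates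
-- between b + 1, b, …, t + 1 and 3 + b, …, 2 + b + t, producing the gaps
-- 2, …, b + 1.  The file develops counting, zigzags and their positions, the
-- reduction to sequences (ShiftedLabelling), the construction (ZigzagPair), and
-- finally the theorem.

open import Defs
open import Data.Bool using (Bool; true; false; not)
open import Data.Bool.Properties using (not-involutive)
open import Data.Fin using (Fin; suc; toℕ; fromℕ<; inject₁; _↑ˡ_; _↑ʳ_; splitAt; join; punchOut)
open import Data.Fin.Properties
  using (any?; punchOut-injective; injective⇒≤; toℕ-injective; toℕ-fromℕ<; toℕ<n; toℕ-inject₁;
         splitAt-↑ˡ; splitAt-↑ʳ; splitAt-join)
  renaming (_≟_ to _≟ᶠ_)
open import Data.Nat using (ℕ; zero; suc; pred; _+_; _*_; _∸_; _≤_; _<_; s≤s; z≤n; s≤s⁻¹; ∣_-_∣; _≤?_; _<?_; _≟_)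
open import Data.Nat.Properties
open import Data.Nat.Tactic.RingSolver using (solve-∀)
open import Data.Product using (Σ; ∃; ∃₂; _×_; _,_; proj₁; proj₂)
open import Data.Sum using (_⊎_; inj₁; inj₂; [_,_]′)
open import Function using (_∘_)
open import Function.Definitions using (Injective)
open import Relation.Binary.PropositionalEquality
open import Relation.Nullary using (¬_; yes; no; contradiction)

-- Pigeonhole: an injective map from Fin M to itself is onto.  Kept opaque:
-- only the statement is used, and unfolding the search is costly.
opaque
  injective⇒surjective : ∀ {M} (h : Fin M → Fin M) → Injective _≡_ _≡_ h →
                         ∀ y → ∃ λ x → h x ≡ y
  injective⇒surjective {suc M} h h-inj y with any? (λ x → h x ≟ᶠ y)
  ... | yes hit  = hit
  ... | no  miss = contradiction (injective⇒≤ squeeze-inj) 1+n≰n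
    where
    avoids : ∀ x → y ≢ h x
    avoids x eq = miss (x , sym eq)
    squeeze : Fin (suc M) → Fin M
    squeeze x = punchOut (avoids x)
    squeeze-inj : Injective _≡_ _≡_ squeeze
    squeeze-inj eq = h-inj (punchOut-injective (avoids _) (avoids _) eq)

module Counting {X : Set} {M : ℕ} (ι : X → Fin M) (ι-inj : Injective _≡_ _≡_ ι)
                (k : ℕ) (g : X → ℕ) (hits : ∀ (i : Fin M) → ∃ λ x → g x ≡ k + toℕ i) where

  private
    preimage : Fin M → X
    preimage i = proj₁ (hits i)

    index-determined : ∀ {i j} → g (preimage i) ≡ g (preimage j) → i ≡ j
    index-determined {i} {j} eq = toℕ-injective (+-cancelˡ-≡ k _ _
      (trans (sym (proj₂ (hits i))) (trans eq (proj₂ (hits j)))))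

    -- preimage is injective and X has at most M elements, so it is onto.
    every-preimage : ∀ x → ∃ λ i → preimage i ≡ x
    every-preimage x
      with injective⇒surjective (ι ∘ preimage) (index-determined ∘ cong g ∘ ι-inj) (ι x)
    ... | i , eq = i , ι-inj eq

  in-interval : ∀ x → ∃ λ i → g x ≡ k + toℕ i
  in-interval x with every-preimage x
  ... | i , refl = i , proj₂ (hits i)

  injective : Injective _≡_ _≡_ g
  injective {x} {y} eq with every-preimage x | every-preimage y
  ... | i , refl | j , refl = cong preimage (index-determined eq)

bit : Bool → ℕ
bit false = 0
bit true  = 1

zigzag : Bool → ℕ → ℕ → ℕ → ℕ
zigzag false lo hi zero    = lo
zigzag true  lo hi zero    = hi
zigzag false lo hi (suc j) = zigzag true (pred lo) hi j
zigzag true  lo hi (suc j) = zigzag false lo (suc hi) j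

-- The positions of the u-th low and the u-th high value of zigzag s.
lowPos highPos : Bool → ℕ → ℕ
lowPos  s u = bit s + (u + u)
highPos s u = lowPos (not s) u

zigzag-low : ∀ s v u hi → zigzag s (v + u) hi (lowPos s u) ≡ v
zigzag-low false v zero    hi = +-identityʳ v
zigzag-low true  v zero    hi = +-identityʳ v
zigzag-low false v (suc u) hi
  rewrite +-suc u u | +-suc v u = zigzag-low true v u hi
zigzag-low true  v (suc u) hi
  rewrite +-suc u u | +-suc v u = zigzag-low true v u (suc hi)

zigzag-high : ∀ s lo hi u → zigzag s lo hi (highPos s u) ≡ hi + u
zigzag-high false lo hi zero    = sym (+-identityʳ hi)
zigzag-high true  lo hi zero    = sym (+-identityʳ hi)
zigzag-high false lo hi (suc u) rewrite +-suc u u | +-suc hi u =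
  zigzag-high false (pred lo) (suc hi) u
zigzag-high true  lo hi (suc u) rewrite +-suc u u | +-suc hi u =
  zigzag-high false lo (suc hi) u

gap : (ℕ → ℕ) → ℕ → ℕ
gap γ j = ∣ γ j - γ (suc j) ∣

distance-to-sum : ∀ m d → ∣ d + m - m ∣ ≡ d
distance-to-sum m d = trans (m≤n⇒∣n-m∣≡n∸m (m≤n+m m d)) (m+n∸n≡m d m)

-- As long as the low values have not run below 0, the gaps of a zigzag grow
-- by one at each step, starting from the distance d between lo and hi.
zigzag-gap : ∀ s lo d j → j ≤ lowPos s lo → gap (zigzag s lo (d + lo)) j ≡ j + d
zigzag-gap false lo      d zero    _ = trans (∣-∣-comm lo (d + lo)) (distance-to-sum lo d)
zigzag-gap true  lo      d zero    _ = distance-to-sum lo d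
zigzag-gap false zero    d (suc j) ()
zigzag-gap false (suc l) d (suc j) j<
  rewrite +-suc d l =
    trans (zigzag-gap true l (suc d) j (≤-trans (s≤s⁻¹ j<) (≤-reflexive (+-suc l l))))
          (+-suc j d)
zigzag-gap true  lo      d (suc j) j<
  = trans (zigzag-gap false lo (suc d) j (s≤s⁻¹ j<)) (+-suc j d)

lowPos-mono : ∀ s {u v} → u ≤ v → lowPos s u ≤ lowPos s v
lowPos-mono s u≤v = +-monoʳ-≤ (bit s) (+-mono-≤ u≤v u≤v)

highPos-bound : ∀ s t u → suc u ≤ bit s + t → highPos s u < suc (lowPos s t)
highPos-bound false t u u<t = s≤s (≤-trans (s≤s (+-monoʳ-≤ u (n≤1+n u)))
                                           (+-mono-≤ u<t u<t))
highPos-bound true  t u u<t = s≤s (m≤n⇒m≤1+n (+-mono-≤ (s≤s⁻¹ u<t) (s≤s⁻¹ u<t)))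

halve-below : ∀ c u t b → u + t ≤ b → c + b ≤ t + t → c + (u + u) ≤ b
halve-below c u t b u+t≤b c+b≤2t = +-cancelʳ-≤ (t + t) _ _ (begin
  c + (u + u) + (t + t)   ≡⟨ regroup c u t ⟩
  (u + t) + (c + (u + t)) ≤⟨ +-mono-≤ u+t≤b (+-monoʳ-≤ c u+t≤b) ⟩
  b + (c + b)             ≤⟨ +-monoʳ-≤ b c+b≤2t ⟩
  b + (t + t)             ∎)
  where
  open ≤-Reasoning
  regroup : ∀ c u t → c + (u + u) + (t + t) ≡ (u + t) + (c + (u + t))
  regroup = solve-∀

halve-above : ∀ c u t b → suc u ≤ t → c + (t + t) ≤ 2 + b → c + (u + u) ≤ b
halve-above c u t b u<t c+2t≤ = +-cancelʳ-≤ 2 _ _ (begin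
  c + (u + u) + 2         ≡⟨ regroup c u ⟩
  c + (suc u + suc u)     ≤⟨ +-monoʳ-≤ c (+-mono-≤ u<t u<t) ⟩
  c + (t + t)             ≤⟨ c+2t≤ ⟩
  2 + b                   ≡⟨ +-comm 2 b ⟩
  b + 2                   ∎)
  where
  open ≤-Reasoning
  regroup : ∀ c u → c + (u + u) + 2 ≡ c + (suc u + suc u)
  regroup = solve-∀

PathPair : ℕ → ℕ → Graph
PathPair a b = P (suc a) ⊕ P (suc b)

GoodLabelling : ℕ → ℕ → ℕ → Set
GoodLabelling a b c = Σ (Elem (PathPair a b) → ℕ) λ f →
  SuperGraceful 2 (PathPair a b) f × EdgeLabelSet (PathPair a b) f 2 c

ValuesCover : ℕ → ℕ → (ℕ → ℕ) → (ℕ → ℕ) → Set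
ValuesCover a b α β = ∀ o → o ≤ a + suc b →
  (∃ λ i → i ≤ a × α i ≡ o) ⊎ (∃ λ j → j ≤ b × β j ≡ o)

GapsCover : ℕ → ℕ → (ℕ → ℕ) → (ℕ → ℕ) → Set
GapsCover a b α β = ∀ d → 2 ≤ d → d ≤ a + suc b →
  (∃ λ i → i < a × gap α i ≡ d) ⊎ (∃ λ j → j < b × gap β j ≡ d)

module ShiftedLabelling (a b : ℕ) (α β : ℕ → ℕ) where

  A : ℕ
  A = a + suc b

  vertexLabel : Fin (suc a + suc b) → ℕ
  vertexLabel v = suc A + [ α ∘ toℕ , β ∘ toℕ ]′ (splitAt (suc a) v)

  label : Elem (PathPair a b) → ℕ
  label (inj₁ v) = vertexLabel v
  label (inj₂ e) = ∣ vertexLabel (proj₁ (endpoint (PathPair a b) e))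
                   - vertexLabel (proj₂ (endpoint (PathPair a b) e)) ∣

  left-vertex : ∀ i → vertexLabel (i ↑ˡ suc b) ≡ suc A + α (toℕ i)
  left-vertex i rewrite splitAt-↑ˡ (suc a) i (suc b) = refl

  right-vertex : ∀ j → vertexLabel (suc a ↑ʳ j) ≡ suc A + β (toℕ j)
  right-vertex j rewrite splitAt-↑ʳ (suc a) (suc b) j = refl

  shifted-gap : ∀ (γ : ℕ → ℕ) (u w : Fin (suc a + suc b)) (j : ℕ) →
                vertexLabel u ≡ suc A + γ j → vertexLabel w ≡ suc A + γ (suc j) →
                ∣ vertexLabel u - vertexLabel w ∣ ≡ gap γ j
  shifted-gap γ u w j u≡ w≡ =
    trans (cong₂ ∣_-_∣ u≡ w≡) (∣m+n-m+o∣≡∣n-o∣ (suc A) (γ j) (γ (suc j)))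

  left-endpoints : ∀ (i : Fin a) →
    endpoint (PathPair a b) (i ↑ˡ b) ≡ (inject₁ i ↑ˡ suc b , suc i ↑ˡ suc b)
  left-endpoints i rewrite splitAt-↑ˡ a i b = refl

  right-endpoints : ∀ (j : Fin b) →
    endpoint (PathPair a b) (a ↑ʳ j) ≡ (suc a ↑ʳ inject₁ j , suc a ↑ʳ suc j)
  right-endpoints j rewrite splitAt-↑ʳ a b j = refl

  left-edge : ∀ (i : Fin a) → label (inj₂ (i ↑ˡ b)) ≡ gap α (toℕ i)
  left-edge i rewrite left-endpoints i =
    shifted-gap α (inject₁ i ↑ˡ suc b) (suc i ↑ˡ suc b) (toℕ i)
      (trans (left-vertex (inject₁ i)) (cong (λ k → suc A + α k) (toℕ-inject₁ i)))
      (left-vertex (suc i))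

  right-edge : ∀ (j : Fin b) → label (inj₂ (a ↑ʳ j)) ≡ gap β (toℕ j)
  right-edge j rewrite right-endpoints j =
    shifted-gap β (suc a ↑ʳ inject₁ j) (suc a ↑ʳ suc j) (toℕ j)
      (trans (right-vertex (inject₁ j)) (cong (λ k → suc A + β k) (toℕ-inject₁ j)))
      (right-vertex (suc j))

  module _ (values : ValuesCover a b α β) (gaps : GapsCover a b α β) where

    vertex-labels : ∀ m → A < m → m ≤ suc A + A → ∃ λ v → vertexLabel v ≡ m
    vertex-labels m A<m m≤ with values (m ∸ suc A)
      (≤-trans (∸-monoˡ-≤ (suc A) m≤) (≤-reflexive (m+n∸m≡n (suc A) A)))
    ... | inj₁ (i , i≤a , αi≡) = fromℕ< (s≤s i≤a) ↑ˡ suc b ,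
          trans (left-vertex _) (trans (cong (λ i → suc A + α i) (toℕ-fromℕ< (s≤s i≤a)))
                (trans (cong (suc A +_) αi≡) (m+[n∸m]≡n A<m)))
    ... | inj₂ (j , j≤b , βj≡) = suc a ↑ʳ fromℕ< (s≤s j≤b) ,
          trans (right-vertex _) (trans (cong (λ j → suc A + β j) (toℕ-fromℕ< (s≤s j≤b)))
                (trans (cong (suc A +_) βj≡) (m+[n∸m]≡n A<m)))

    edge-labels : ∀ d → 2 ≤ d → d ≤ A → ∃ λ e → label (inj₂ e) ≡ d
    edge-labels d 2≤d d≤A with gaps d 2≤d d≤A
    ... | inj₁ (i , i<a , gap≡) = fromℕ< i<a ↑ˡ b ,
          trans (left-edge _) (trans (cong (gap α) (toℕ-fromℕ< i<a)) gap≡)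
    ... | inj₂ (j , j<b , gap≡) = a ↑ʳ fromℕ< j<b ,
          trans (right-edge _) (trans (cong (gap β) (toℕ-fromℕ< j<b)) gap≡)

    G : Graph
    G = PathPair a b

    largest-label : suc (p G + q G) ≡ suc A + A
    largest-label = trans (sym (+-suc (suc A) (a + b))) (cong (suc A +_) (sym (+-suc a b)))

    every-label : ∀ (k : Fin (p G + q G)) → ∃ λ x → label x ≡ 2 + toℕ k
    every-label k with 2 + toℕ k ≤? A
    ... | yes small = let (e , eq) = edge-labels _ (s≤s (s≤s z≤n)) small in inj₂ e , eq
    ... | no  large = let (v , eq) = vertex-labels _ (≰⇒> large) below-top in inj₁ v , eq
      where
      below-top : 2 + toℕ k ≤ suc A + A
      below-top = ≤-trans (s≤s (toℕ<n k)) (≤-reflexive largest-label)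

    join-injective : Injective _≡_ _≡_ (join (p G) (q G))
    join-injective {x} {y} eq =
      trans (sym (splitAt-join _ _ x)) (trans (cong (splitAt (p G)) eq) (splitAt-join _ _ y))

    open Counting (join (p G) (q G)) join-injective 2 label every-label

    in-range : ∀ x → InRange 2 (2 + p G + q G ∸ 1) (label x)
    in-range x = subst (InRange 2 (2 + p G + q G ∸ 1)) (sym (proj₂ (in-interval x)))
      (s≤s (s≤s z≤n) , s≤s (toℕ<n (proj₁ (in-interval x))))

    onto : ∀ m → InRange 2 (2 + p G + q G ∸ 1) m → ∃ λ x → label x ≡ m
    onto (suc (suc m)) (s≤s (s≤s _) , m<) with every-label (fromℕ< (s≤s⁻¹ m<))
    ... | x , eq = x , trans eq (cong (2 +_) (toℕ-fromℕ< (s≤s⁻¹ m<)))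

    -- A label above A belongs to a vertex, so no edge can carry it.
    edge-in-range : ∀ e → InRange 2 A (label (inj₂ e))
    edge-in-range e = proj₁ (in-range (inj₂ e)) , ≮⇒≥ not-above
      where
      not-above : ¬ (A < label (inj₂ e))
      not-above A< =
        let (v , eq) = vertex-labels _ A<
                         (≤-trans (proj₂ (in-range (inj₂ e))) (≤-reflexive largest-label))
        in contradiction (injective {inj₁ v} {inj₂ e} eq) λ ()

    good-labelling : GoodLabelling a b A
    good-labelling = label ,
      record { injective = injective ; into = in-range ; onto = onto ; edgeLabel = λ _ → refl } ,
      edge-in-range , λ d (2≤d , d≤A) → edge-labels d 2≤d d≤A

-- The long path has a + 1 vertices where a = 2t + 1 + bit e, the short one
-- b + 1, and b + 2 ≤ a ≤ b + 3.  The long path zigzags between t, t − 1, …, 0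
-- and 3 + b + t, …, A and ends at the hole 2 + b; the short path zigzags
-- between b + 1, b, …, t + 1 and 3 + b, …, 2 + b + t, starting on the other side.
module ZigzagPair (e : Bool) (t b : ℕ)
                  (b+2≤a : bit (not e) + b ≤ t + t)
                  (a≤b+3 : lowPos e t ≤ 2 + b) where

  a A : ℕ
  a = suc (lowPos e t)
  A = a + suc b

  α : ℕ → ℕ
  α j with j <? a
  ... | yes _ = zigzag e t (3 + b + t) j
  ... | no  _ = 2 + b

  β : ℕ → ℕ
  β = zigzag (not e) (suc b) (3 + b)

  α-zigzag : ∀ {j} → j < a → α j ≡ zigzag e t (3 + b + t) j
  α-zigzag {j} j<a with j <? a
  ... | yes _   = refl
  ... | no  j≮a = contradiction j<a j≮a

  α-end : α a ≡ 2 + b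
  α-end with a <? a
  ... | yes a<a = contradiction a<a (<-irrefl refl)
  ... | no  _   = refl

  β-highPos : ∀ u → highPos (not e) u ≡ lowPos e u
  β-highPos u = cong (λ s → lowPos s u) (not-involutive e)

  α-low : ∀ o → o ≤ t → ∃ λ i → i ≤ a × α i ≡ o
  α-low o o≤t = lowPos e u , <⇒≤ pos<a ,
    trans (α-zigzag pos<a)
          (subst (λ lo → zigzag e lo (3 + b + t) (lowPos e u) ≡ o) (m+[n∸m]≡n o≤t)
                 (zigzag-low e o u (3 + b + t)))
    where
    u = t ∸ o
    pos<a : lowPos e u < a
    pos<a = s≤s (lowPos-mono e (m∸n≤m t o))

  β-low : ∀ o → t < o → o ≤ suc b → ∃ λ j → j ≤ b × β j ≡ o
  β-low o t<o o≤b+1 = lowPos (not e) u , halve-below (bit (not e)) u t b u+t≤b b+2≤a ,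
    subst (λ lo → zigzag (not e) lo (3 + b) (lowPos (not e) u) ≡ o) (m+[n∸m]≡n o≤b+1)
          (zigzag-low (not e) o u (3 + b))
    where
    u = suc b ∸ o
    u+t≤b : u + t ≤ b
    u+t≤b = s≤s⁻¹ (begin
      suc (u + t) ≡⟨ sym (+-suc u t) ⟩
      u + suc t   ≤⟨ +-monoʳ-≤ u t<o ⟩
      u + o       ≡⟨ m∸n+n≡m o≤b+1 ⟩
      suc b       ∎)
      where open ≤-Reasoning

  β-high : ∀ o → 2 + b < o → o ≤ 2 + b + t → ∃ λ j → j ≤ b × β j ≡ o
  β-high o b+2<o o≤ = lowPos e u , halve-above (bit e) u t b u<t a≤b+3 ,
    trans (cong β (sym (β-highPos u))) (trans (zigzag-high (not e) _ (3 + b) u) (m+[n∸m]≡n b+2<o))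
    where
    u = o ∸ (3 + b)
    u<t : suc u ≤ t
    u<t = +-cancelˡ-≤ (2 + b) _ _ (begin
      2 + b + suc u ≡⟨ +-suc (2 + b) u ⟩
      3 + b + u     ≡⟨ m+[n∸m]≡n b+2<o ⟩
      o             ≤⟨ o≤ ⟩
      2 + b + t     ∎)
      where open ≤-Reasoning

  α-high : ∀ o → 2 + b + t < o → o ≤ A → ∃ λ i → i ≤ a × α i ≡ o
  α-high o b+t+2<o o≤A = highPos e u , <⇒≤ pos<a ,
    trans (α-zigzag pos<a) (trans (zigzag-high e t _ u) (m+[n∸m]≡n b+t+2<o))
    where
    u = o ∸ (3 + b + t)
    u<e+t : suc u ≤ bit e + t
    u<e+t = +-cancelˡ-≤ (2 + b + t) _ _ (begin
      2 + b + t + suc u ≡⟨ +-suc (2 + b + t) u ⟩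
      3 + b + t + u     ≡⟨ m+[n∸m]≡n b+t+2<o ⟩
      o                 ≤⟨ o≤A ⟩
      A                 ≡⟨ regroup (bit e) b t ⟩
      2 + b + t + (bit e + t) ∎)
      where
      open ≤-Reasoning
      regroup : ∀ c b t → suc (c + (t + t)) + suc b ≡ 2 + b + t + (c + t)
      regroup = solve-∀
    pos<a : highPos e u < a
    pos<a = highPos-bound e t u u<e+t

  values-cover : ValuesCover a b α β
  values-cover o o≤A with o ≤? t
  ... | yes o≤t = inj₁ (α-low o o≤t)
  ... | no  o≰t with o ≤? suc b
  ...   | yes o≤b+1 = inj₂ (β-low o (≰⇒> o≰t) o≤b+1)
  ...   | no  o≰b+1 with o ≟ 2 + b
  ...     | yes refl = inj₁ (a , ≤-refl , α-end)
  ...     | no  o≢b+2 with o ≤? 2 + b + t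
  ...       | yes o≤ = inj₂ (β-high o b+2<o o≤)
    where b+2<o = ≤∧≢⇒< (≰⇒> o≰b+1) (o≢b+2 ∘ sym)
  ...       | no  o≰ = inj₁ (α-high o (≰⇒> o≰) o≤A)

  α-gap : ∀ j → suc j < a → gap α j ≡ j + (3 + b)
  α-gap j j+1<a = trans (cong₂ ∣_-_∣ (α-zigzag (<-trans (n<1+n j) j+1<a)) (α-zigzag j+1<a))
                        (zigzag-gap e t (3 + b) j (<⇒≤ (s≤s⁻¹ j+1<a)))

  α-last-gap : gap α (lowPos e t) ≡ 2 + b
  α-last-gap = cong₂ ∣_-_∣ (trans (α-zigzag ≤-refl) (zigzag-low e 0 t (3 + b + t))) α-end

  β-gap : ∀ j → j < b → gap β j ≡ j + 2
  β-gap j j<b = zigzag-gap (not e) (suc b) 2 j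
    (≤-trans (<⇒≤ j<b) (≤-trans (n≤1+n b)
      (≤-trans (m≤m+n (suc b) (suc b)) (m≤n+m _ (bit (not e))))))

  gaps-cover : GapsCover a b α β
  gaps-cover d@(suc (suc j)) (s≤s (s≤s _)) d≤A with d ≤? suc b
  ... | yes d≤b+1 = inj₂ (j , s≤s⁻¹ d≤b+1 , trans (β-gap j (s≤s⁻¹ d≤b+1)) (+-comm j 2))
  ... | no  d≰b+1 with d ≟ 2 + b
  ...   | yes refl = inj₁ (lowPos e t , ≤-refl , α-last-gap)
  ...   | no  d≢b+2 = inj₁ (k , <-trans (n<1+n k) k+1<a , trans (α-gap k k+1<a) (m∸n+n≡m b+2<d))
    where
    b+2<d = ≤∧≢⇒< (≰⇒> d≰b+1) (d≢b+2 ∘ sym)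
    k = d ∸ (3 + b)
    k+1<a : suc k < a
    k+1<a = +-cancelʳ-≤ (suc b) _ _ (begin
      2 + k + suc b ≡⟨ regroup k b ⟩
      k + (3 + b)   ≡⟨ m∸n+n≡m b+2<d ⟩
      d             ≤⟨ d≤A ⟩
      A             ∎)
      where
      open ≤-Reasoning
      regroup : ∀ k b → 2 + k + suc b ≡ k + (3 + b)
      regroup = solve-∀

  labelling : GoodLabelling a b A
  labelling = ShiftedLabelling.good-labelling a b α β values-cover gaps-cover

parity : ∀ n → ∃₂ λ e t → n ≡ lowPos e t
parity zero = false , 0 , refl
parity (suc n) with parity n
... | false , t , refl = true  , t     , refl
... | true  , t , refl = false , suc t , cong suc (sym (+-suc t t))

shift-bit : ∀ e {b m} → suc b ≤ bit e + m → bit (not e) + b ≤ m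
shift-bit false b<m = b<m
shift-bit true  b<m = s≤s⁻¹ b<m

path-pair-labelling : ∀ a b → 2 + b ≤ a → a ≤ 3 + b → GoodLabelling a b (a + suc b)
path-pair-labelling zero    b ()    _
path-pair-labelling (suc a) b b+2≤a a≤b+3 with parity a
... | e , t , refl = ZigzagPair.labelling e t b (shift-bit e (s≤s⁻¹ b+2≤a)) (s≤s⁻¹ a≤b+3)

two-or-three : ∀ b {r} → r ≡ 2 ⊎ r ≡ 3 → 2 + b ≤ b + r × b + r ≤ 3 + b
two-or-three b (inj₁ refl) = ≤-reflexive (+-comm 2 b) , ≤-trans (≤-reflexive (+-comm b 2)) (n≤1+n _)
two-or-three b (inj₂ refl) = ≤-trans (n≤1+n (2 + b)) (≤-reflexive (+-comm 3 b)) , ≤-reflexive (+-comm b 3)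

largest-edge-label : ∀ b r → b + r + suc b ≡ 2 * suc b + r ∸ 1
largest-edge-label b r = regroup b r
  where
  -- 2 * suc b + r ∸ 1 computes to b + (suc b + 0) + r.
  regroup : ∀ b r → b + r + suc b ≡ b + (suc b + 0) + r
  regroup = solve-∀

-- With n = b + 1 the graph is PathPair (b + r) b (the construction only needs n ≥ 1).
theorem4p12 : (n r : ℕ) → 2 ≤ n → (r ≡ 2 ⊎ r ≡ 3) →
    Σ (Elem (P (n + r) ⊕ P n) → ℕ) λ f →
      SuperGraceful 2 (P (n + r) ⊕ P n) f
      × EdgeLabelSet (P (n + r) ⊕ P n) f 2 (2 * n + r ∸ 1)
theorem4p12 zero    r () r∈[2,3]
theorem4p12 (suc b) r _  r∈[2,3] =
  subst (GoodLabelling (b + r) b) (largest-edge-label b r)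
        (path-pair-labelling (b + r) b b+2≤a a≤b+3)
  where
  b+2≤a = proj₁ (two-or-three b r∈[2,3])
  a≤b+3 = proj₂ (two-or-three b r∈[2,3])
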